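{- Let $p,q$ be primes with $2<p<q$, and let $t$ be an integer with $0\le t\le d_1-1$. Write $t=aq'+bp'+c$ where $a=\lfloor t/q'\rfloor$ (the maximal nonnegative integer $a$ admitting such a representation), $b\ge0$, and $0\le c\le p'-1$. Then: (i) $a\le p-1$; (ii) if $a=p-1$ then $b=0$; (iii) $b\le\kappa'$; (iv) if $b=\kappa'$ then $c<\lambda'$, and in particular $p>3$; (v) if $b\ge\kappa$ then $a\le p-2$.
   Context: Let $p,q$ be primes with $2<p<q$, put $p'=(p-1)/2$, $q'=(q-1)/2$ and $d_1=p'q$. Define integers $\kappa,\lambda,\kappa',\lambda'$ by $q=\kappa p+\lambda$ with $1\le\lambda\le p-1$ and $q'=\kappa'p'+\lambda'$ with $0\le\lambda'\le p'-1$. -}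

module Defs where

open import Data.Nat using (ℕ; _∸_; _*_)
open import Data.Nat.DivMod using (_/_)

-- half n = (n - 1) / 2, i.e. p' = (p-1)/2 for odd p
half : ℕ → ℕ
half n = (n ∸ 1) / 2

d₁ : ℕ → ℕ → ℕ
d₁ p q = half p * q

{-# OPTIONS --safe #-}
-- Write t = a q' + r with r = b p' + c < q'.  Since t < p' q = 2 p' q' + p' and p' < q', the
-- quotient a is at most 2 p' ≤ p - 1, and when a = 2 p' the remainder r is even below p', which
-- forces b = 0.  Comparing r < q' = κ' p' + λ' < (κ' + 1) p' digit by digit gives b ≤ κ', and
-- c < λ' when b = κ'.  Finally κ ≥ 1 because q > p, so b ≥ κ rules out b = 0 and hence a = p - 1.
module Submission where

open import Defs
open import Data.Nat.Base
  using (ℕ; zero; suc; _+_; _*_; _∸_; _≤_; _<_; _≥_; NonZero; z≤n; s≤s; s≤s⁻¹; z<s; >-nonZero)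
open import Data.Nat.DivMod using (_/_; _%_; m≡m%n+[m/n]*n; m%n<n; m*n/n≡m; m/n*n≤m; /-monoˡ-≤)
open import Data.Nat.Divisibility using (divides; hasNonTrivialDivisor)
open import Data.Nat.Primality using (Prime; prime)
open import Data.Nat.Properties
open import Data.Nat.Tactic.RingSolver using (solve-∀)
open import Data.Product using (_×_; _,_)
open import Function using (_∘_)
open import Relation.Nullary using (contradiction)
open import Relation.Binary.PropositionalEquality using (_≡_; refl; sym; trans; cong; subst)

half*2≤pred : ∀ n → half n * 2 ≤ n ∸ 1
half*2≤pred n = m/n*n≤m (n ∸ 1) 2

half>0 : ∀ n → 2 < n → 0 < half n
half>0 1 (s≤s ())
half>0 2 (s≤s (s≤s ()))
half>0 (suc (suc (suc k))) _ = /-monoˡ-≤ {2} {2 + k} 2 (s≤s (s≤s z≤n))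

prime>2⇒≡1+half*2 : ∀ {q} → Prime q → 2 < q → q ≡ suc (half q * 2)
prime>2⇒≡1+half*2 {q} (prime irreducible) 2<q with q % 2 | m≡m%n+[m/n]*n q 2 | m%n<n q 2
... | zero  | q≡ | _ = contradiction (hasNonTrivialDivisor 2<q (divides (q / 2) q≡)) irreducible
... | suc zero | q≡ | _ = trans q≡ (cong (λ h → suc (h * 2)) (sym half≡q/2))
  where
  half≡q/2 : half q ≡ q / 2
  half≡q/2 = trans (cong (λ n → (n ∸ 1) / 2) q≡) (m*n/n≡m (q / 2) 2)
... | suc (suc _) | _ | s≤s (s≤s ())

remainder<divisor : ∀ {t a r Q} .{{_ : NonZero Q}} → t ≡ a * Q + r → a ≡ t / Q → r < Q
remainder<divisor {t} {a} {r} {Q} t≡ a≡ = subst (_< Q) (sym r≡t%Q) (m%n<n t Q)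
  where
  r≡t%Q : r ≡ t % Q
  r≡t%Q = +-cancelˡ-≡ (a * Q) r (t % Q) (trans (sym t≡) (trans (m≡m%n+[m/n]*n t Q)
            (trans (+-comm (t % Q) _) (cong (λ x → x * Q + t % Q) (sym a≡)))))

m*n+o<p*n⇒m<p : ∀ {m n o p} → m * n + o < p * n → m < p
m*n+o<p*n⇒m<p {m} {n} {o} {p} lt = *-cancelʳ-< n m p (≤-<-trans (m≤m+n (m * n) o) lt)

quotient≤2P : ∀ {P Q t a r} → P < Q → t < P * 2 * Q + P → t ≡ a * Q + r → a ≤ P * 2
quotient≤2P {P} {Q} {t} {a} {r} P<Q t< t≡ = s≤s⁻¹ (m*n+o<p*n⇒m<p (begin-strict
  a * Q + r        ≡⟨ sym t≡ ⟩
  t                <⟨ t< ⟩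
  P * 2 * Q + P    <⟨ +-monoʳ-< (P * 2 * Q) P<Q ⟩
  P * 2 * Q + Q    ≡⟨ +-comm (P * 2 * Q) Q ⟩
  suc (P * 2) * Q  ∎))
  where open ≤-Reasoning

quotient≡2P⇒remainder<P : ∀ {P Q t r} → t < P * 2 * Q + P → t ≡ P * 2 * Q + r → r < P
quotient≡2P⇒remainder<P {P} {Q} {r = r} t< t≡ = +-cancelˡ-< (P * 2 * Q) r P (subst (_< P * 2 * Q + P) t≡ t<)

division-quotient>0 : ∀ {q p κ ℓ} → q ≡ κ * p + ℓ → ℓ < p → p ≤ q → 0 < κ
division-quotient>0 {κ = zero}  refl ℓ<p p≤ℓ = contradiction ℓ<p (≤⇒≯ p≤ℓ)
division-quotient>0 {κ = suc _} _    _   _   = z<s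

dividend<[1+quotient]*divisor : ∀ {q p κ ℓ} → q ≡ κ * p + ℓ → ℓ < p → q < suc κ * p
dividend<[1+quotient]*divisor {p = p} {κ} {ℓ} refl ℓ<p =
  subst (κ * p + ℓ <_) (+-comm (κ * p) p) (+-monoʳ-< (κ * p) ℓ<p)

half<half : ∀ {p q} .{{_ : NonZero p}} → q ≡ suc (half q * 2) → p < q → half p < half q
half<half {p} {q} q≡ p<q =
  *-cancelʳ-< 2 (half p) (half q) (≤-<-trans (half*2≤pred p) (pred-mono-< (subst (p <_) q≡ p<q)))

2≤half⇒4< : ∀ n → 2 ≤ half n → 4 < n
2≤half⇒4< (suc m) 2≤half = s≤s (≤-trans (*-monoˡ-≤ 2 2≤half) (half*2≤pred (suc m)))

d₁≡ : ∀ {p q} → q ≡ suc (half q * 2) → d₁ p q ≡ half p * 2 * half q + half p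
d₁≡ {p} {q} q≡ = trans (cong (half p *_) q≡) (distrib (half p) (half q))
  where
  distrib : ∀ P Q → P * suc (Q * 2) ≡ P * 2 * Q + P
  distrib = solve-∀

lemma4p2 : (p q : ℕ) → Prime p → Prime q → 2 < p → p < q →
    (κ ℓ κ′ ℓ′ : ℕ) →
    q ≡ κ * p + ℓ → 1 ≤ ℓ → ℓ ≤ p ∸ 1 →
    half q ≡ κ′ * half p + ℓ′ → ℓ′ ≤ half p ∸ 1 →
    .{{_ : NonZero (half q)}} →
    (t : ℕ) → t ≤ d₁ p q ∸ 1 →
    (a b c : ℕ) → t ≡ a * half q + b * half p + c → c ≤ half p ∸ 1 →
    a ≡ t / half q →
    (a ≤ p ∸ 1)
    × (a ≡ p ∸ 1 → b ≡ 0)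
    × (b ≤ κ′)
    × (b ≡ κ′ → (c < ℓ′) × (3 < p))
    × (b ≥ κ → a ≤ p ∸ 2)
lemma4p2 p@(suc (suc k)) q _ q-prime 2<p p<q κ ℓ κ′ ℓ′ q≡ _ ℓ≤ Q≡ ℓ′≤ t t≤ a b c t≡ _ a≡ =
  a≤p-1 , top⇒b≡0 , b≤κ′ , b≡κ′⇒ , b≥κ⇒
  where
  P Q : ℕ
  P = half p
  Q = half q
  instance
    P≢0 : NonZero P
    P≢0 = >-nonZero (half>0 p 2<p)
  q≡1+Q*2 : q ≡ suc (Q * 2)
  q≡1+Q*2 = prime>2⇒≡1+half*2 q-prime (<-trans 2<p p<q)
  P<Q : P < Q
  P<Q = half<half q≡1+Q*2 p<q
  t<d₁ : t < P * 2 * Q + P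
  t<d₁ = subst (t <_) (d₁≡ {p} q≡1+Q*2) (m≤pred[n]⇒suc[m]≤n {{>-nonZero d₁>0}} t≤)
    where
    d₁>0 : 0 < d₁ p q
    d₁>0 = *-mono-< (half>0 p 2<p) (<-trans 2<p p<q)
  t≡′ : t ≡ a * Q + (b * P + c)
  t≡′ = trans t≡ (+-assoc (a * Q) (b * P) c)
  r<Q : b * P + c < Q
  r<Q = remainder<divisor t≡′ a≡
  Q<[1+κ′]*P : Q < suc κ′ * P
  Q<[1+κ′]*P = dividend<[1+quotient]*divisor {p = P} {κ′} Q≡ (m≤pred[n]⇒suc[m]≤n ℓ′≤)
  a≤P*2 : a ≤ P * 2
  a≤P*2 = quotient≤2P P<Q t<d₁ t≡′
  a≤p-1 : a ≤ p ∸ 1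
  a≤p-1 = ≤-trans a≤P*2 (half*2≤pred p)
  top⇒b≡0 : a ≡ p ∸ 1 → b ≡ 0
  top⇒b≡0 refl = n<1⇒n≡0 (m*n+o<p*n⇒m<p (subst (b * P + c <_) (sym (+-identityʳ P)) r<P))
    where
    r<P : b * P + c < P
    r<P = quotient≡2P⇒remainder<P t<d₁ (trans t≡′ (cong (λ x → x * Q + (b * P + c)) (≤-antisym a≤P*2 (half*2≤pred p))))
  b≤κ′ : b ≤ κ′
  b≤κ′ = s≤s⁻¹ (m*n+o<p*n⇒m<p (<-trans r<Q Q<[1+κ′]*P))
  b≡κ′⇒ : b ≡ κ′ → (c < ℓ′) × (3 < p)
  b≡κ′⇒ refl = c<ℓ′ , <-trans (n<1+n 3) (2≤half⇒4< p (≤-trans (s≤s (s≤s z≤n)) 2+c≤P))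
    where
    c<ℓ′ : c < ℓ′
    c<ℓ′ = +-cancelˡ-< (b * P) c ℓ′ (subst (b * P + c <_) Q≡ r<Q)
    2+c≤P : 2 + c ≤ P
    2+c≤P = m≤pred[n]⇒suc[m]≤n (≤-trans c<ℓ′ ℓ′≤)
  b≥κ⇒ : b ≥ κ → a ≤ p ∸ 2
  b≥κ⇒ b≥κ = s≤s⁻¹ (≤∧≢⇒< a≤p-1 (m<n⇒n≢0 (<-≤-trans κ>0 b≥κ) ∘ top⇒b≡0))
    where
    κ>0 : 0 < κ
    κ>0 = division-quotient>0 q≡ (s≤s ℓ≤) (<⇒≤ p<q)
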